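{- Let $G$ be a connected graph with minimum degree $\delta(G)\geq 2$ containing an induced $4$-cycle $(x_1,x_2,x_3,x_4)$. Then $b_t(G)\leq \sum_{i=1}^{4} d(x_i)-6$.
   Context: $d(v)$ denotes the degree of $v$. For a graph $G$ without isolated vertices, a set $D\subseteq V(G)$ is a total dominating set if every vertex $v\in V(G)$ has a neighbor in $D$; $\gamma_t(G)$ is the minimum cardinality of a total dominating set. A total bondage edge set is a set $B\subseteq E(G)$ such that $G-B$ has no isolated vertices and $\gamma_t(G-B)>\gamma_t(G)$. The total bondage number $b_t(G)$ is the minimum cardinality of a total bondage edge set of $G$, and $b_t(G)=\infty$ if no total bondage edge set exists. -}

module Defs where

open import Data.Nat using (ℕ; zero; suc; _+_; _<_; _≤_; _<ᵇ_)
open import Data.Fin using (Fin; toℕ)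
open import Data.Bool using (Bool; true; false; _∧_; not; if_then_else_)
open import Data.List using (List; map; allFin)
open import Data.Nat.ListAction using (sum)
open import Data.Product using (Σ; _×_; ∃; _,_)
open import Relation.Binary.PropositionalEquality using (_≡_; _≢_)

record Graph (n : ℕ) : Set where
  field
    adj   : Fin n → Fin n → Bool
    sym   : ∀ i j → adj i j ≡ adj j i
    irrefl : ∀ i → adj i i ≡ false
open Graph public

count : {n : ℕ} → (Fin n → Bool) → ℕ
count {n} f = sum (map (λ i → if f i then 1 else 0) (allFin n))

deg : {n : ℕ} → Graph n → Fin n → ℕ
deg G v = count (adj G v)

data Reach {n : ℕ} (G : Graph n) : Fin n → Fin n → Set where
  here : ∀ {u} → Reach G u u
  step : ∀ {u v w} → adj G u v ≡ true → Reach G v w → Reach G u w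

Connected : {n : ℕ} → Graph n → Set
Connected {n} G = ∀ (u v : Fin n) → Reach G u v

MinDegreeAtLeast : {n : ℕ} → Graph n → ℕ → Set
MinDegreeAtLeast {n} G k = ∀ (v : Fin n) → k ≤ deg G v

NoIsolated : {n : ℕ} → Graph n → Set
NoIsolated {n} G = ∀ (v : Fin n) → ∃ λ u → adj G v u ≡ true

VSet : ℕ → Set
VSet n = Fin n → Bool

IsTDS : {n : ℕ} → Graph n → VSet n → Set
IsTDS {n} G D = ∀ (v : Fin n) → ∃ λ u → (adj G v u ≡ true) × (D u ≡ true)

TotalDomNumberIs : {n : ℕ} → Graph n → ℕ → Set
TotalDomNumberIs {n} G k =
  (Σ (VSet n) λ D → IsTDS G D × count D ≡ k) ×
  (∀ (D : VSet n) → IsTDS G D → k ≤ count D)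

record EdgeSubset {n : ℕ} (G : Graph n) : Set where
  field
    rem    : Fin n → Fin n → Bool
    remSym : ∀ i j → rem i j ≡ rem j i
    remSub : ∀ i j → rem i j ≡ true → adj G i j ≡ true
open EdgeSubset public

edgeCount : {n : ℕ} {G : Graph n} → EdgeSubset G → ℕ
edgeCount B = sum (map (λ i → count (λ j → rem B i j ∧ (toℕ i <ᵇ toℕ j))) (allFin _))

deleteEdges : {n : ℕ} (G : Graph n) → EdgeSubset G → Graph n
deleteEdges G B = record
  { adj = λ i j → adj G i j ∧ not (rem B i j)
  ; sym = λ i j → pf i j
  ; irrefl = λ i → irr i
  }
  where
  open import Relation.Binary.PropositionalEquality using (cong₂; refl)
  pf : ∀ i j → (adj G i j ∧ not (rem B i j)) ≡ (adj G j i ∧ not (rem B j i))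
  pf i j = cong₂ (λ a b → a ∧ not b) (Graph.sym G i j) (remSym B i j)
  irr : ∀ i → (adj G i i ∧ not (rem B i i)) ≡ false
  irr i with adj G i i | Graph.irrefl G i
  ... | .false | refl = refl

IsTotalBondageSet : {n : ℕ} (G : Graph n) → EdgeSubset G → Set
IsTotalBondageSet G B =
  NoIsolated (deleteEdges G B) ×
  (∀ k k' → TotalDomNumberIs G k → TotalDomNumberIs (deleteEdges G B) k' → k < k')

-- b_t(G) ≤ m  (b_t(G) = ∞ when no total bondage set exists, so this
-- says some total bondage edge set has at most m edges)
TotalBondageAtMost : {n : ℕ} → Graph n → ℕ → Set
TotalBondageAtMost G m = Σ (EdgeSubset G) λ B → IsTotalBondageSet G B × edgeCount B ≤ m

InducedC4 : {n : ℕ} → Graph n → Fin n → Fin n → Fin n → Fin n → Set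
InducedC4 G x1 x2 x3 x4 =
  (x1 ≢ x3) × (x2 ≢ x4) ×
  (adj G x1 x2 ≡ true) × (adj G x2 x3 ≡ true) ×
  (adj G x3 x4 ≡ true) × (adj G x4 x1 ≡ true) ×
  (adj G x1 x3 ≡ false) × (adj G x2 x4 ≡ false)

{-# OPTIONS --safe #-}
-- Let ab be an edge and c ∉ {a, b} a vertex with neighbours p ≠ q in N(a) ∪ N(b), p ∉ {a, b}.
-- Delete all edges at a and at b except ab itself, and all edges from c to vertices outside
-- N(a) ∪ N(b): at most (d(a) − 1) + (d(b) − 1) + (d(c) − 2) edges.  Now ab is a component, so
-- every total dominating set of the new graph contains a and b and also a dominator of c, which
-- is adjacent in G to a or to b; dropping b or a respectively gives a smaller total dominating
-- set of G, so γt strictly increases.  No vertex becomes isolated as long as every vertex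
-- outside {a, b} has a neighbour outside {a, b} (the edge cp survives).
-- On the cycle take (a, b, c) = (x₁, x₂, x₃), unless some z has N(z) ⊆ {x₁, x₂}; then
-- δ ≥ 2 forces d(z) = 2 and (a, b, c) = (z, x₁, x₃) works.

module Submission where

open import Defs hiding (sym)
open import Data.Nat using (ℕ; zero; suc; _+_; _∸_; _≤_; _<_; _<ᵇ_; z≤n; s≤s; s≤s⁻¹)
open import Data.Nat.Properties
  using (≤-trans; ≤-reflexive; ≤-<-trans; +-mono-≤; +-monoˡ-≤; +-monoʳ-≤; +-comm; +-assoc; +-identityʳ;
         n≮0; m+n≤o⇒m≤o∸n; +-0-commutativeMonoid; module ≤-Reasoning)
open import Data.Fin using (Fin; zero; suc; toℕ; _≟_)
open import Data.Fin.Properties using (any?)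
open import Data.Bool using (Bool; true; false; _∧_; _∨_; not; if_then_else_)
open import Data.Bool.Properties
  using (¬-not; not-injective; ∧-assoc; ∧-zeroʳ; ∨-comm; ∨-identityʳ; ∨-zeroʳ)
import Data.Bool.Properties as Bool
open import Data.List using (map; allFin; tabulate)
open import Data.List.Properties using (map-tabulate)
open import Data.Nat.ListAction using (sum)
open import Data.Product using (Σ; ∃; _×_; _,_; proj₁; proj₂; map₂)
open import Data.Sum using (_⊎_; inj₁; inj₂; [_,_]′)
open import Data.Empty using (⊥-elim)
open import Function using (_∘_; id)
open import Relation.Nullary using (¬_; Dec; yes; no; does; contradiction)
open import Relation.Nullary.Decidable using (dec-true; dec-false; decidable-stable; _×-dec_; ¬?)
open import Relation.Binary.PropositionalEquality
  using (_≡_; _≢_; refl; sym; trans; cong; cong₂; subst; ≢-sym; module ≡-Reasoning)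
open import Algebra.Properties.CommutativeMonoid.Sum +-0-commutativeMonoid
  using (sum-syntax; ∑-distrib-+; ∑-comm; sum-cong-≗; sum-replicate-zero)
open import Data.Nat.Solver using (module +-*-Solver)

private
  variable
    n : ℕ

ind : Bool → ℕ
ind b = if b then 1 else 0

ind-≤1 : ∀ x → ind x ≤ 1
ind-≤1 true  = s≤s z≤n
ind-≤1 false = z≤n

ind-mono : ∀ {x y} → (x ≡ true → y ≡ true) → ind x ≤ ind y
ind-mono {true}  x⇒y rewrite x⇒y refl = s≤s z≤n
ind-mono {false} _ = z≤n

ind-split : ∀ x y → ind x ≡ ind (y ∧ x) + ind (x ∧ not y)
ind-split true  true  = refl
ind-split true  false = refl
ind-split false true  = refl
ind-split false false = refl

ind-∨-∧ : ∀ x y z → ind ((x ∨ y) ∧ z) ≤ ind (x ∧ z) + ind (y ∧ z)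
ind-∨-∧ true  y     true  = s≤s z≤n
ind-∨-∧ false true  true  = s≤s z≤n
ind-∨-∧ false false true  = z≤n
ind-∨-∧ x     y     false rewrite ∧-zeroʳ (x ∨ y) = z≤n

ind-∧-disjoint : ∀ x {y z} → (y ≡ true → z ≡ false) → ind (x ∧ y) + ind (x ∧ z) ≤ ind x
ind-∧-disjoint false _ = z≤n
ind-∧-disjoint true {true}  y⇒¬z rewrite y⇒¬z refl = s≤s z≤n
ind-∧-disjoint true {false} _ = ind-≤1 _

∨-true : ∀ {x y} → x ∨ y ≡ true → x ≡ true ⊎ y ≡ true
∨-true {true}  _ = inj₁ refl
∨-true {false} y = inj₂ y

∨-false : ∀ {x y} → x ∨ y ≡ false → x ≡ false × y ≡ false
∨-false {false} y = refl , y

∨-introʳ : ∀ x {y} → y ≡ true → x ∨ y ≡ true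
∨-introʳ x refl = ∨-zeroʳ x

∧-true : ∀ {x y} → x ∧ y ≡ true → x ≡ true × y ≡ true
∧-true {true} y = refl , y

<ᵇ-asym : ∀ m k → (m <ᵇ k) ≡ true → (k <ᵇ m) ≡ false
<ᵇ-asym zero    (suc k) _ = refl
<ᵇ-asym (suc m) (suc k) m<k = <ᵇ-asym m k m<k

_==_ : Fin n → Fin n → Bool
i == j = does (i ≟ j)

==-refl : (i : Fin n) → i == i ≡ true
==-refl i = dec-true (i ≟ i) refl

==-≢ : {i j : Fin n} → i ≢ j → i == j ≡ false
==-≢ {i = i} {j} = dec-false (i ≟ j)

==⇒≡ : {i j : Fin n} → i == j ≡ true → i ≡ j
==⇒≡ {i = i} {j} i==j with i ≟ j
... | yes i≡j = i≡j
==⇒≡ {i = i} {j} () | no _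

==-false⇒≢ : {i j : Fin n} → i == j ≡ false → i ≢ j
==-false⇒≢ {i = i} i≠j refl = contradiction (trans (sym (==-refl i)) i≠j) λ ()

∑-mono-≤ : {f g : Fin n → ℕ} → (∀ i → f i ≤ g i) → ∑[ i < n ] f i ≤ ∑[ i < n ] g i
∑-mono-≤ {zero}  _   = z≤n
∑-mono-≤ {suc n} f≤g = +-mono-≤ (f≤g zero) (∑-mono-≤ (f≤g ∘ suc))

∑∑-distrib-+ : (f g : Fin n → Fin n → ℕ) →
  ∑[ i < n ] ∑[ j < n ] (f i j + g i j) ≡ ∑[ i < n ] ∑[ j < n ] f i j + ∑[ i < n ] ∑[ j < n ] g i j
∑∑-distrib-+ {n} f g = trans (sum-cong-≗ (λ i → ∑-distrib-+ (f i) (g i))) 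
  (∑-distrib-+ (λ i → ∑[ j < n ] f i j) (λ i → ∑[ j < n ] g i j))

∑-select : (b : Fin n → Bool) (x : Fin n) → ∑[ i < n ] ind (i == x ∧ b i) ≡ ind (b x)
∑-select {suc n} b zero    = trans (cong (ind (b zero) +_) (sum-replicate-zero n)) (+-identityʳ _)
∑-select {suc n} b (suc x) = ∑-select (b ∘ suc) x

sum-tabulate : (f : Fin n → ℕ) → sum (tabulate f) ≡ ∑[ i < n ] f i
sum-tabulate {zero}  f = refl
sum-tabulate {suc n} f = cong (f zero +_) (sum-tabulate (f ∘ suc))

sum-map-allFin : (f : Fin n → ℕ) → sum (map f (allFin n)) ≡ ∑[ i < n ] f i
sum-map-allFin f = trans (cong sum (map-tabulate id f)) (sum-tabulate f)

_⊆_ : VSet n → VSet n → Set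
f ⊆ g = ∀ {i} → f i ≡ true → g i ≡ true

_∖_ : VSet n → VSet n → VSet n
(f ∖ g) i = f i ∧ not (g i)

_─_ : VSet n → Fin n → VSet n
f ─ w = f ∖ (_== w)

∖-⊆ : {f g : VSet n} → (f ∖ g) ⊆ f
∖-⊆ = proj₁ ∘ ∧-true

∖-out : {f g : VSet n} {i : Fin n} → g i ≡ true → (f ∖ g) i ≡ false
∖-out {f = f} {i = i} gi rewrite gi = ∧-zeroʳ (f i)

∖-false : {f g : VSet n} {i : Fin n} → (f ∖ g) i ≡ false → f i ≡ true → g i ≡ true
∖-false f∖g fi rewrite fi = not-injective f∖g

─-intro : {f : VSet n} {i w : Fin n} → f i ≡ true → i ≢ w → (f ─ w) i ≡ true
─-intro fi i≢w = cong₂ (λ x y → x ∧ not y) fi (==-≢ i≢w)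

─-elim : {f : VSet n} {i w : Fin n} → (f ─ w) i ≡ true → f i ≡ true × i ≢ w
─-elim {f = f} {i} f─w with ∧-true {f i} f─w
... | fi , i≠w = fi , ==-false⇒≢ (not-injective i≠w)

∖-true-≢ : {f g : VSet n} {i j : Fin n} → (f ∖ g) i ≡ true → g j ≡ true → i ≢ j
∖-true-≢ {f = f} {g} f∖g gj refl = contradiction (trans (sym f∖g) (∖-out {f = f} {g} gj)) λ ()

─-self : (f : VSet n) (w : Fin n) → (f ─ w) w ≡ false
─-self f w = ∖-out {f = f} {g = _== w} (==-refl w)

count-∑ : (f : VSet n) → count f ≡ ∑[ i < n ] ind (f i)
count-∑ f = sum-map-allFin (ind ∘ f)

count-mono : {f g : VSet n} → f ⊆ g → count f ≤ count g
count-mono {n} {f} {g} f⊆g = begin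
  count f               ≡⟨ count-∑ f ⟩
  ∑[ i < n ] ind (f i)  ≤⟨ ∑-mono-≤ (λ i → ind-mono (f⊆g {i})) ⟩
  ∑[ i < n ] ind (g i)  ≡⟨ count-∑ g ⟨
  count g               ∎
  where open ≤-Reasoning

count-∅ : {f : VSet n} → (∀ i → f i ≡ false) → count f ≡ 0
count-∅ {n} {f} none = trans (count-∑ f) (trans (sum-cong-≗ (cong ind ∘ none)) (sum-replicate-zero n))

count-split : (f : VSet n) (w : Fin n) → count f ≡ ind (f w) + count (f ─ w)
count-split {n} f w = begin
  count f
    ≡⟨ count-∑ f ⟩
  ∑[ i < n ] ind (f i)
    ≡⟨ sum-cong-≗ (λ i → ind-split (f i) (i == w)) ⟩
  ∑[ i < n ] (ind (i == w ∧ f i) + ind ((f ─ w) i))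
    ≡⟨ ∑-distrib-+ (λ i → ind (i == w ∧ f i)) (λ i → ind ((f ─ w) i)) ⟩
  ∑[ i < n ] ind (i == w ∧ f i) + ∑[ i < n ] ind ((f ─ w) i)
    ≡⟨ cong₂ _+_ (∑-select f w) (sym (count-∑ (f ─ w))) ⟩
  ind (f w) + count (f ─ w)
    ∎
  where open ≡-Reasoning

count-─-< : {f : VSet n} {w : Fin n} → f w ≡ true → count (f ─ w) < count f
count-─-< {f = f} {w} fw =
  ≤-reflexive (sym (trans (count-split f w) (cong (λ b → ind b + count (f ─ w)) fw)))

count-pos : {f : VSet n} → 0 < count f → ∃ λ i → f i ≡ true
count-pos {n} {f} pos with any? {n} (λ i → f i Bool.≟ true)
... | yes found = found
... | no none = contradiction (subst (0 <_) (count-∅ λ i → ¬-not λ fi → none (i , fi)) pos) n≮0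

count≥2⇒∃≢ : {f : VSet n} → 2 ≤ count f → (c : Fin n) → ∃ λ u → f u ≡ true × u ≢ c
count≥2⇒∃≢ {f = f} 2≤f c = map₂ (─-elim {f = f}) (count-pos {f = f ─ c} 1≤f─c)
  where
  1≤f─c : 1 ≤ count (f ─ c)
  1≤f─c = s≤s⁻¹ (≤-trans 2≤f (≤-trans (≤-reflexive (count-split f c))
                                        (+-monoˡ-≤ (count (f ─ c)) (ind-≤1 (f c)))))

count-≤2 : {f : VSet n} {x y : Fin n} → (∀ {i} → f i ≡ true → i ≡ x ⊎ i ≡ y) → count f ≤ 2
count-≤2 {f = f} {x} {y} f⊆xy = begin
  count f
    ≡⟨ count-split f x ⟩
  ind (f x) + count (f ─ x)
    ≡⟨ cong (ind (f x) +_) (count-split (f ─ x) y) ⟩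
  ind (f x) + (ind ((f ─ x) y) + count ((f ─ x) ─ y))
    ≡⟨ cong (λ k → ind (f x) + (ind ((f ─ x) y) + k)) (count-∅ empty) ⟩
  ind (f x) + (ind ((f ─ x) y) + 0)
    ≤⟨ +-mono-≤ (ind-≤1 (f x)) (+-monoˡ-≤ 0 (ind-≤1 ((f ─ x) y))) ⟩
  2
    ∎
  where
  open ≤-Reasoning
  empty : ∀ i → ((f ─ x) ─ y) i ≡ false
  empty i = ¬-not λ i∈ →
    let (i∈f─x , i≢y) = ─-elim {f = f ─ x} i∈
        (i∈f , i≢x)   = ─-elim {f = f} i∈f─x
    in [ i≢x , i≢y ]′ (f⊆xy i∈f)

adj-sym : (G : Graph n) {i j : Fin n} → adj G i j ≡ true → adj G j i ≡ true
adj-sym G {i} {j} = trans (Graph.sym G j i)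

adj-≢ : (G : Graph n) {i j : Fin n} → adj G i j ≡ true → i ≢ j
adj-≢ G {i} Gii refl = contradiction (trans (sym Gii) (Graph.irrefl G i)) λ ()

Subgraph : Graph n → Graph n → Set
Subgraph H G = ∀ {i j} → adj H i j ≡ true → adj G i j ≡ true

starRel : Fin n → VSet n → Fin n → Fin n → Bool
starRel x R i j = (i == x ∧ R j) ∨ (j == x ∧ R i)

starRel-away : (x : Fin n) (R : VSet n) {i j : Fin n} → i ≢ x → j ≢ x → starRel x R i j ≡ false
starRel-away x R {i} {j} i≢x j≢x = cong₂ (λ s t → (s ∧ R j) ∨ (t ∧ R i)) (==-≢ i≢x) (==-≢ j≢x)

starRel-at : (x : Fin n) (R : VSet n) {j : Fin n} → j ≢ x → starRel x R x j ≡ R j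
starRel-at x R {j} j≢x =
  trans (cong₂ (λ s t → (s ∧ R j) ∨ (t ∧ R x)) (==-refl x) (==-≢ j≢x)) (∨-identityʳ (R j))

starRel-at′ : (x : Fin n) (R : VSet n) {j : Fin n} → j ≢ x → starRel x R j x ≡ R j
starRel-at′ x R {j} j≢x = trans (∨-comm (j == x ∧ R x) (x == x ∧ R j)) (starRel-at x R j≢x)

module _ {G : Graph n} where

  _∪_ : EdgeSubset G → EdgeSubset G → EdgeSubset G
  B ∪ C = record
    { rem    = λ i j → rem B i j ∨ rem C i j
    ; remSym = λ i j → cong₂ _∨_ (remSym B i j) (remSym C i j)
    ; remSub = λ i j → [ remSub B i j , remSub C i j ]′ ∘ ∨-true
    }

  star : (x : Fin n) (R : VSet n) → R ⊆ adj G x → EdgeSubset G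
  star x R R⊆Nx = record
    { rem    = starRel x R
    ; remSym = λ i j → ∨-comm (i == x ∧ R j) (j == x ∧ R i)
    ; remSub = λ i j → [ at-x , adj-sym G ∘ at-x ]′ ∘ ∨-true
    }
    where
    at-x : ∀ {i j} → (i == x ∧ R j) ≡ true → adj G i j ≡ true
    at-x {i} i=x∧Rj with i==x , Rj ← ∧-true {i == x} i=x∧Rj with refl ← ==⇒≡ {i = i} {x} i==x =
      R⊆Nx Rj

  lt : Fin n → Fin n → Bool
  lt i j = toℕ i <ᵇ toℕ j

  edgeCount-∑ : (B : EdgeSubset G) → edgeCount B ≡ ∑[ i < n ] ∑[ j < n ] ind (rem B i j ∧ lt i j)
  edgeCount-∑ B = trans (sum-map-allFin (λ i → count (λ j → rem B i j ∧ lt i j)))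
                        (sum-cong-≗ (λ i → count-∑ (λ j → rem B i j ∧ lt i j)))

  edgeCount-∪ : (B C : EdgeSubset G) → edgeCount (B ∪ C) ≤ edgeCount B + edgeCount C
  edgeCount-∪ B C = begin
    edgeCount (B ∪ C)
      ≡⟨ edgeCount-∑ (B ∪ C) ⟩
    ∑[ i < n ] ∑[ j < n ] ind ((rem B i j ∨ rem C i j) ∧ lt i j)
      ≤⟨ ∑-mono-≤ (λ i → ∑-mono-≤ (λ j → ind-∨-∧ (rem B i j) (rem C i j) (lt i j))) ⟩
    ∑[ i < n ] ∑[ j < n ] (ind (rem B i j ∧ lt i j) + ind (rem C i j ∧ lt i j))
      ≡⟨ ∑∑-distrib-+ (λ i j → ind (rem B i j ∧ lt i j)) (λ i j → ind (rem C i j ∧ lt i j)) ⟩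
    ∑[ i < n ] ∑[ j < n ] ind (rem B i j ∧ lt i j) + ∑[ i < n ] ∑[ j < n ] ind (rem C i j ∧ lt i j)
      ≡⟨ cong₂ _+_ (edgeCount-∑ B) (edgeCount-∑ C) ⟨
    edgeCount B + edgeCount C
      ∎
    where open ≤-Reasoning

  edgeCount-star : (x : Fin n) (R : VSet n) (R⊆Nx : R ⊆ adj G x) → edgeCount (star x R R⊆Nx) ≤ count R
  edgeCount-star x R R⊆Nx = begin
    edgeCount (star x R R⊆Nx)
      ≡⟨ edgeCount-∑ (star x R R⊆Nx) ⟩
    ∑[ i < n ] ∑[ j < n ] ind (rem (star x R R⊆Nx) i j ∧ lt i j)
      ≤⟨ ∑-mono-≤ (λ i → ∑-mono-≤ (split i)) ⟩
    ∑[ i < n ] ∑[ j < n ] (ind (i == x ∧ (R j ∧ lt i j)) + ind (j == x ∧ (R i ∧ lt i j)))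
      ≡⟨ ∑∑-distrib-+ (λ i j → ind (i == x ∧ (R j ∧ lt i j)))
                      (λ i j → ind (j == x ∧ (R i ∧ lt i j))) ⟩
    ∑[ i < n ] ∑[ j < n ] ind (i == x ∧ (R j ∧ lt i j)) +
    ∑[ i < n ] ∑[ j < n ] ind (j == x ∧ (R i ∧ lt i j))
      ≡⟨ cong₂ _+_ (trans (∑-comm (λ i j → ind (i == x ∧ (R j ∧ lt i j))))
                          (sum-cong-≗ (λ j → ∑-select (λ i → R j ∧ lt i j) x)))
                   (sum-cong-≗ (λ i → ∑-select (λ j → R i ∧ lt i j) x)) ⟩
    ∑[ j < n ] ind (R j ∧ lt x j) + ∑[ j < n ] ind (R j ∧ lt j x)
      ≡⟨ ∑-distrib-+ (λ j → ind (R j ∧ lt x j)) (λ j → ind (R j ∧ lt j x)) ⟨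
    ∑[ j < n ] (ind (R j ∧ lt x j) + ind (R j ∧ lt j x))
      ≤⟨ ∑-mono-≤ (λ j → ind-∧-disjoint (R j) (<ᵇ-asym (toℕ x) (toℕ j))) ⟩
    ∑[ j < n ] ind (R j)
      ≡⟨ count-∑ R ⟨
    count R
      ∎
    where
    open ≤-Reasoning
    split : ∀ i j → ind (rem (star x R R⊆Nx) i j ∧ lt i j) ≤
                    ind (i == x ∧ (R j ∧ lt i j)) + ind (j == x ∧ (R i ∧ lt i j))
    split i j rewrite sym (∧-assoc (i == x) (R j) (lt i j)) | sym (∧-assoc (j == x) (R i) (lt i j)) =
      ind-∨-∧ (i == x ∧ R j) (j == x ∧ R i) (lt i j)

  deleteEdges-⊆ : (B : EdgeSubset G) → Subgraph (deleteEdges G B) G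
  deleteEdges-⊆ B = proj₁ ∘ ∧-true

  deleteEdges-removed : (B : EdgeSubset G) {i j : Fin n} →
                        adj (deleteEdges G B) i j ≡ true → rem B i j ≡ false
  deleteEdges-removed B = not-injective ∘ proj₂ ∘ ∧-true

  deleteEdges-kept : (B : EdgeSubset G) {i j : Fin n} →
                     adj G i j ≡ true → rem B i j ≡ false → adj (deleteEdges G B) i j ≡ true
  deleteEdges-kept B = cong₂ (λ s t → s ∧ not t)

IsTDS-─ : {G H : Graph n} {D : VSet n} {w y u : Fin n} → Subgraph H G → IsTDS H D →
          (∀ {v} → adj H w v ≡ true → v ≡ y) → adj G y u ≡ true → D u ≡ true → u ≢ w →
          IsTDS G (D ─ w)
IsTDS-─ {H = H} {D} {y = y} {u} H⊆G tds w-sees-y yu Du u≢w x with x ≟ y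
... | yes refl = u , yu , ─-intro {f = D} Du u≢w
... | no x≢y with v , xv , Dv ← tds x =
  v , H⊆G xv , ─-intro {f = D} Dv λ { refl → x≢y (w-sees-y (adj-sym H xv)) }

IsTDS-∋-only-neighbour : {G : Graph n} {D : VSet n} {x y : Fin n} → IsTDS G D →
                         (∀ {v} → adj G x v ≡ true → v ≡ y) → D y ≡ true
IsTDS-∋-only-neighbour {x = x} tds x-sees-y with v , xv , Dv ← tds x with refl ← x-sees-y xv = Dv

totalDomNumber-< : {G H : Graph n} →
  (∀ D′ → IsTDS H D′ → Σ (VSet n) λ D → IsTDS G D × count D < count D′) →
  ∀ k k′ → TotalDomNumberIs G k → TotalDomNumberIs H k′ → k < k′
totalDomNumber-< shrink _ _ (_ , minimal) ((D′ , tds , refl) , _) with D , tdsD , smaller ← shrink D′ tds =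
  ≤-<-trans (minimal D tdsD) smaller

HasNeighbourOutside : Graph n → Fin n → Fin n → Fin n → Set
HasNeighbourOutside G a b x = ∃ λ w → adj G x w ≡ true × w ≢ a × w ≢ b

hasNeighbourOutside? : (G : Graph n) (a b x : Fin n) → Dec (HasNeighbourOutside G a b x)
hasNeighbourOutside? G a b x = any? (λ w → (adj G x w Bool.≟ true) ×-dec ¬? (w ≟ a) ×-dec ¬? (w ≟ b))

neighbours-within : {G : Graph n} {a b z : Fin n} → ¬ HasNeighbourOutside G a b z →
                    ∀ {w} → adj G z w ≡ true → w ≡ a ⊎ w ≡ b
neighbours-within {a = a} {b} ¬outside {w} zw with w ≟ a | w ≟ b
... | yes w≡a | _       = inj₁ w≡a
... | no _    | yes w≡b = inj₂ w≡b
... | no w≢a  | no w≢b  = ⊥-elim (¬outside (w , zw , w≢a , w≢b))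

outside-of-pendant : {G : Graph n} {a b c z : Fin n} → MinDegreeAtLeast G 2 →
  (∀ {w} → adj G z w ≡ true → w ≡ a ⊎ w ≡ b) → adj G b c ≡ true → c ≢ z → c ≢ a →
  ∀ {x} → x ≢ z → x ≢ a → HasNeighbourOutside G z a x
outside-of-pendant {G = G} {a} {c = c} {z} δ≥2 N[z]⊆ab bc c≢z c≢a {x} x≢z x≢a
  with u , xu , u≢a ← count≥2⇒∃≢ (δ≥2 x) a with u ≟ z
... | no u≢z = u , xu , u≢z , u≢a
... | yes refl with N[z]⊆ab (adj-sym G xu)
...   | inj₁ x≡a = ⊥-elim (x≢a x≡a)
...   | inj₂ refl = c , bc , c≢z , c≢a

module IsolateEdge {n : ℕ} (G : Graph n) (δ≥2 : MinDegreeAtLeast G 2) {a b c p q : Fin n}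
  (ab : adj G a b ≡ true) (c≢a : c ≢ a) (c≢b : c ≢ b)
  (cp : adj G c p ≡ true) (cq : adj G c q ≡ true) (q≢p : q ≢ p) (p≢a : p ≢ a) (p≢b : p ≢ b)
  (p∈N[a,b] : adj G a p ∨ adj G b p ≡ true) (q∈N[a,b] : adj G a q ∨ adj G b q ≡ true)
  (outside : ∀ {x} → x ≢ a → x ≢ b → HasNeighbourOutside G a b x) where

  N[a,b] : VSet n
  N[a,b] u = adj G a u ∨ adj G b u

  Ra Rb Rc : VSet n
  Ra = adj G a ─ b
  Rb = adj G b ─ a
  Rc = adj G c ∖ N[a,b]

  Ra⊆ : Ra ⊆ adj G a
  Ra⊆ = ∖-⊆ {f = adj G a} {_== b}
  Rb⊆ : Rb ⊆ adj G b
  Rb⊆ = ∖-⊆ {f = adj G b} {_== a}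
  Rc⊆ : Rc ⊆ adj G c
  Rc⊆ = ∖-⊆ {f = adj G c} {N[a,b]}

  starA starB starC : EdgeSubset G
  starA = star a Ra Ra⊆
  starB = star b Rb Rb⊆
  starC = star c Rc Rc⊆

  B : EdgeSubset G
  B = starA ∪ (starB ∪ starC)

  H : Graph n
  H = deleteEdges G B

  kept : ∀ {i j} → adj G i j ≡ true →
         rem starA i j ≡ false → rem starB i j ≡ false → rem starC i j ≡ false → adj H i j ≡ true
  kept Gij ∉A ∉B ∉C = deleteEdges-kept B Gij (cong₂ _∨_ ∉A (cong₂ _∨_ ∉B ∉C))

  not-removed : ∀ {i j} → adj H i j ≡ true →
                rem starA i j ≡ false × rem starB i j ≡ false × rem starC i j ≡ false
  not-removed Hij with ∉A , ∉BC ← ∨-false (deleteEdges-removed B Hij) = ∉A , ∨-false ∉BC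

  a-sees-only-b : ∀ {v} → adj H a v ≡ true → v ≡ b
  a-sees-only-b {v} Hav = ==⇒≡ (∖-false {f = adj G a} {_== b} v∉Ra (deleteEdges-⊆ B Hav))
    where
    v∉Ra : Ra v ≡ false
    v∉Ra = trans (sym (starRel-at a Ra (≢-sym (adj-≢ H Hav)))) (proj₁ (not-removed Hav))

  b-sees-only-a : ∀ {v} → adj H b v ≡ true → v ≡ a
  b-sees-only-a {v} Hbv = ==⇒≡ (∖-false {f = adj G b} {_== a} v∉Rb (deleteEdges-⊆ B Hbv))
    where
    v∉Rb : Rb v ≡ false
    v∉Rb = trans (sym (starRel-at b Rb (≢-sym (adj-≢ H Hbv)))) (proj₁ (proj₂ (not-removed Hbv)))

  c-sees-N[a,b] : ∀ {u} → adj H c u ≡ true → N[a,b] u ≡ true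
  c-sees-N[a,b] {u} Hcu = ∖-false {f = adj G c} {N[a,b]} u∉Rc (deleteEdges-⊆ B Hcu)
    where
    u∉Rc : Rc u ≡ false
    u∉Rc = trans (sym (starRel-at c Rc (≢-sym (adj-≢ H Hcu)))) (proj₂ (proj₂ (not-removed Hcu)))

  H-ab : adj H a b ≡ true
  H-ab = kept ab (trans (starRel-at a Ra b≢a) (─-self (adj G a) b))
                 (trans (starRel-at′ b Rb a≢b) (─-self (adj G b) a))
                 (starRel-away c Rc (≢-sym c≢a) (≢-sym c≢b))
    where
    a≢b = adj-≢ G ab
    b≢a = ≢-sym a≢b

  H-cp : adj H c p ≡ true
  H-cp = kept cp (starRel-away a Ra c≢a p≢a) (starRel-away b Rb c≢b p≢b)
                 (trans (starRel-at c Rc (≢-sym (adj-≢ G cp))) (∖-out {f = adj G c} {N[a,b]} p∈N[a,b]))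

  away-not-isolated : ∀ {x} → x ≢ a → x ≢ b → x ≢ c → ∃ λ u → adj H x u ≡ true
  away-not-isolated {x} x≢a x≢b x≢c with w , xw , w≢a , w≢b ← outside x≢a x≢b | w ≟ c | N[a,b] x Bool.≟ true
  ... | no w≢c | _ =
    w , kept xw (starRel-away a Ra x≢a w≢a) (starRel-away b Rb x≢b w≢b) (starRel-away c Rc x≢c w≢c)
  ... | yes refl | yes x∈N =
    c , kept xw (starRel-away a Ra x≢a w≢a) (starRel-away b Rb x≢b w≢b)
                (trans (starRel-at′ c Rc x≢c) (∖-out {f = adj G c} {N[a,b]} x∈N))
  ... | yes refl | no x∉N with u , xu , u≢c ← count≥2⇒∃≢ (δ≥2 x) c =
    u , kept xu (starRel-away a Ra x≢a u≢a) (starRel-away b Rb x≢b u≢b) (starRel-away c Rc x≢c u≢c)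
    where
    u≢a : u ≢ a
    u≢a refl = x∉N (cong (_∨ adj G b x) (adj-sym G xu))
    u≢b : u ≢ b
    u≢b refl = x∉N (∨-introʳ (adj G a x) (adj-sym G xu))

  H-noIsolated : NoIsolated H
  H-noIsolated x = by-cases (x ≟ a) (x ≟ b) (x ≟ c)
    where
    by-cases : Dec (x ≡ a) → Dec (x ≡ b) → Dec (x ≡ c) → ∃ λ u → adj H x u ≡ true
    by-cases (yes x≡a) _         _         = b , subst (λ v → adj H v b ≡ true) (sym x≡a) H-ab
    by-cases (no _)    (yes x≡b) _         = a , subst (λ v → adj H v a ≡ true) (sym x≡b) (adj-sym H H-ab)
    by-cases (no _)    (no _)    (yes x≡c) = p , subst (λ v → adj H v p ≡ true) (sym x≡c) H-cp
    by-cases (no x≢a)  (no x≢b)  (no x≢c)  = away-not-isolated x≢a x≢b x≢c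

  drop : ∀ {D′ w y u} → IsTDS H D′ →
         (∀ {v} → adj H w v ≡ true → v ≡ y) → (∀ {v} → adj H y v ≡ true → v ≡ w) →
         adj G y u ≡ true → D′ u ≡ true → u ≢ w →
         Σ (VSet n) λ D → IsTDS G D × count D < count D′
  drop {D′} {w} {y} tds w-sees-y y-sees-w yu D′u u≢w =
    D′ ─ w , IsTDS-─ {G = G} {H} (deleteEdges-⊆ B) tds w-sees-y yu D′u u≢w
           , count-─-< {f = D′} (IsTDS-∋-only-neighbour {G = H} {x = y} tds y-sees-w)

  tds-shrinks : ∀ D′ → IsTDS H D′ → Σ (VSet n) λ D → IsTDS G D × count D < count D′
  tds-shrinks D′ tds with u , Hcu , D′u ← tds c with ∨-true (c-sees-N[a,b] Hcu)
  ... | inj₁ au = drop tds b-sees-only-a a-sees-only-b au D′u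
                    λ { refl → c≢a (b-sees-only-a (adj-sym H Hcu)) }
  ... | inj₂ bu = drop tds a-sees-only-b b-sees-only-a bu D′u
                    λ { refl → c≢b (a-sees-only-b (adj-sym H Hcu)) }

  edgeCount-B≤ : edgeCount B ≤ count Ra + (count Rb + count Rc)
  edgeCount-B≤ =
    ≤-trans (edgeCount-∪ {G = G} starA (starB ∪ starC))
      (+-mono-≤ (edgeCount-star {G = G} a Ra Ra⊆)
        (≤-trans (edgeCount-∪ {G = G} starB starC)
          (+-mono-≤ (edgeCount-star {G = G} b Rb Rb⊆) (edgeCount-star {G = G} c Rc Rc⊆))))

  Ra<deg-a : 1 + count Ra ≤ deg G a
  Ra<deg-a = count-─-< {f = adj G a} ab

  Rb<deg-b : 1 + count Rb ≤ deg G b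
  Rb<deg-b = count-─-< {f = adj G b} (adj-sym G ab)

  Rc+2≤deg-c : 2 + count Rc ≤ deg G c
  Rc+2≤deg-c = begin
    2 + count Rc                   ≤⟨ +-monoʳ-≤ 2 (count-mono {f = Rc} Rc⊆N[c]─p─q) ⟩
    2 + count ((adj G c ─ p) ─ q)  ≤⟨ s≤s (count-─-< {f = adj G c ─ p} (─-intro {f = adj G c} cq q≢p)) ⟩
    1 + count (adj G c ─ p)        ≤⟨ count-─-< {f = adj G c} cp ⟩
    deg G c                        ∎
    where
    open ≤-Reasoning
    Rc⊆N[c]─p─q : Rc ⊆ ((adj G c ─ p) ─ q)
    Rc⊆N[c]─p─q i∈Rc =
      ─-intro {f = adj G c ─ p}
        (─-intro {f = adj G c} (Rc⊆ i∈Rc) (∖-true-≢ {f = adj G c} i∈Rc p∈N[a,b]))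
        (∖-true-≢ {f = adj G c} i∈Rc q∈N[a,b])

  cost : edgeCount B + 4 ≤ deg G a + deg G b + deg G c
  cost = begin
    edgeCount B + 4
      ≤⟨ +-monoˡ-≤ 4 edgeCount-B≤ ⟩
    count Ra + (count Rb + count Rc) + 4
      ≡⟨ regroup (count Ra) (count Rb) (count Rc) ⟩
    (1 + count Ra) + (1 + count Rb) + (2 + count Rc)
      ≤⟨ +-mono-≤ (+-mono-≤ Ra<deg-a Rb<deg-b) Rc+2≤deg-c ⟩
    deg G a + deg G b + deg G c
      ∎
    where
    open ≤-Reasoning
    open +-*-Solver
    regroup : ∀ x y z → x + (y + z) + 4 ≡ (1 + x) + (1 + y) + (2 + z)
    regroup = solve 3 (λ x y z → x :+ (y :+ z) :+ con 4 := (con 1 :+ x) :+ (con 1 :+ y) :+ (con 2 :+ z)) refl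

  isolating-bondage : Σ (EdgeSubset G) λ B →
                      IsTotalBondageSet G B × edgeCount B + 4 ≤ deg G a + deg G b + deg G c
  isolating-bondage = B , (H-noIsolated , totalDomNumber-< {G = G} {H} tds-shrinks) , cost

e+4≤s⇒e≤s+t∸6 : ∀ {e s t} → e + 4 ≤ s → 2 ≤ t → e ≤ s + t ∸ 6
e+4≤s⇒e≤s+t∸6 {e} {s} {t} e+4≤s 2≤t =
  m+n≤o⇒m≤o∸n e (subst (_≤ s + t) (+-assoc e 4 2) (+-mono-≤ e+4≤s 2≤t))

module FourCycle {n : ℕ} (G : Graph n) (δ≥2 : MinDegreeAtLeast G 2) {x1 x2 x3 x4 : Fin n}
  (x1≢x3 : x1 ≢ x3) (x2≢x4 : x2 ≢ x4) (x1x2 : adj G x1 x2 ≡ true) (x2x3 : adj G x2 x3 ≡ true)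
  (x3x4 : adj G x3 x4 ≡ true) (x4x1 : adj G x4 x1 ≡ true) where

  BondageBound : Set
  BondageBound = TotalBondageAtMost G ((deg G x1 + deg G x2 + deg G x3 + deg G x4) ∸ 6)

  x1x4 : adj G x1 x4 ≡ true
  x1x4 = adj-sym G x4x1
  x3≢x1 : x3 ≢ x1
  x3≢x1 = ≢-sym x1≢x3
  x4≢x1 : x4 ≢ x1
  x4≢x1 = adj-≢ G x4x1
  x4≢x2 : x4 ≢ x2
  x4≢x2 = ≢-sym x2≢x4
  x3≢x2 : x3 ≢ x2
  x3≢x2 = adj-≢ G x2x3 ∘ sym

  isolating-x1x2 : (∀ {x} → x ≢ x1 → x ≢ x2 → HasNeighbourOutside G x1 x2 x) → BondageBound
  isolating-x1x2 outside
    with B , isBondage , cost ← IsolateEdge.isolating-bondage G δ≥2 x1x2 x3≢x1 x3≢x2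
           x3x4 (adj-sym G x2x3) x2≢x4 x4≢x1 x4≢x2 (cong (_∨ adj G x2 x4) x1x4) (cong (_∨ adj G x2 x2) x1x2)
           outside =
    B , isBondage , e+4≤s⇒e≤s+t∸6 cost (δ≥2 x4)

  module Pendant {z : Fin n} (¬outside : ¬ HasNeighbourOutside G x1 x2 z) where

    N[z]⊆x1x2 : ∀ {w} → adj G z w ≡ true → w ≡ x1 ⊎ w ≡ x2
    N[z]⊆x1x2 = neighbours-within {G = G} ¬outside

    deg-z≤2 : deg G z ≤ 2
    deg-z≤2 = count-≤2 {f = adj G z} N[z]⊆x1x2

    zx1 : adj G z x1 ≡ true
    zx1 with u , zu , u≢x2 ← count≥2⇒∃≢ (δ≥2 z) x2 with N[z]⊆x1x2 zu
    ... | inj₁ refl = zu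
    ... | inj₂ u≡x2 = ⊥-elim (u≢x2 u≡x2)

    x3≢z : x3 ≢ z
    x3≢z refl = [ x4≢x1 , x4≢x2 ]′ (N[z]⊆x1x2 x3x4)

    z≢x2 : z ≢ x2
    z≢x2 refl = [ x3≢x1 , x3≢x2 ]′ (N[z]⊆x1x2 x2x3)

    isolating-zx1 : BondageBound
    isolating-zx1
      with B , isBondage , cost ← IsolateEdge.isolating-bondage G δ≥2 zx1 x3≢z x3≢x1 (adj-sym G x2x3) x3x4
             (≢-sym x2≢x4) (≢-sym z≢x2) (adj-≢ G x1x2 ∘ sym)
             (∨-introʳ (adj G z x2) x1x2) (∨-introʳ (adj G z x4) x1x4)
             (outside-of-pendant {G = G} δ≥2 N[z]⊆x1x2 x2x3 x3≢z x3≢x1) =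
      B , isBondage , e+4≤s⇒e≤s+t∸6 (begin
        edgeCount B + 4
          ≤⟨ cost ⟩
        deg G z + deg G x1 + deg G x3
          ≤⟨ +-monoˡ-≤ (deg G x3) (+-monoˡ-≤ (deg G x1) (≤-trans deg-z≤2 (δ≥2 x2))) ⟩
        deg G x2 + deg G x1 + deg G x3
          ≡⟨ cong (_+ deg G x3) (+-comm (deg G x2) (deg G x1)) ⟩
        deg G x1 + deg G x2 + deg G x3
          ∎) (δ≥2 x4)
      where open ≤-Reasoning

  bondageBound : BondageBound
  bondageBound with any? (¬? ∘ hasNeighbourOutside? G x1 x2)
  ... | yes (_ , ¬outside) = Pendant.isolating-zx1 ¬outside
  ... | no noPendant = isolating-x1x2 λ {x} _ _ →
    decidable-stable (hasNeighbourOutside? G x1 x2 x) λ ¬outside → noPendant (x , ¬outside)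

mainTheorem9 : (n : ℕ) (G : Graph n) → Connected G → MinDegreeAtLeast G 2 →
    (x1 x2 x3 x4 : Fin n) → InducedC4 G x1 x2 x3 x4 →
    TotalBondageAtMost G ((deg G x1 + deg G x2 + deg G x3 + deg G x4) ∸ 6)
mainTheorem9 n G _ δ≥2 x1 x2 x3 x4 (x1≢x3 , x2≢x4 , x1x2 , x2x3 , x3x4 , x4x1 , _) =
  FourCycle.bondageBound G δ≥2 x1≢x3 x2≢x4 x1x2 x2x3 x3x4 x4x1
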